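{- Every W-logic $\mathsf{WL}$ enjoys Craig interpolation: for all formulas $A,B$ of $\mathcal L$, if $\mathsf{WL}\vdash A\to B$, then there is a formula $C$ of $\mathcal L$ such that $\mathsf{WL}\vdash A\to C$, $\mathsf{WL}\vdash C\to B$, and $\mathrm{var}(C)\subseteq\mathrm{var}(A)\cap\mathrm{var}(B)$.
   Context: The language $\mathcal{L}$ consists of the formulas built from a countable set $\mathrm{Atm}$ of propositional variables by $A ::= p \mid \bot \mid A\land A \mid A\lor A \mid A\to A \mid \Box A \mid \Diamond A$; $\top := \bot\to\bot$, $\neg A := A\to\bot$. For a formula $A$, $\mathrm{var}(A)=\{\bot\}\cup\{p\in\mathrm{Atm}: p \text{ occurs in } A\}$. Axiom schemes and rules (for all $A,B$): (Mon$_\Box$) from $A\to B$ infer $\Box A\to\Box B$; (Mon$_\Diamond$) from $A\to B$ infer $\Diamond A\to\Diamond B$; (C$_\Box$) $\Box A\land\Box B\to\Box(A\land B)$; (K$_\Diamond$) $\Box(A\to B)\to(\Diamond A\to\Diamond B)$; (N$_\Box$) $\Box\top$; (T$_\Box$) $\Box A\to A$; (T$_\Diamond$) $A\to\Diamond A$; (D) $\Box A\to\Diamond A$; (P$_\Diamond$) $\Diamond\top$; (Dual$_\land$) $\neg(\Box A\land\Diamond\neg A)$. The W-logics are obtained by adding to an axiomatisation of intuitionistic propositional logic (all $\mathcal L$-instances, with modus ponens): $\mathsf{WM}$ := Dual$_\land$ + Mon$_\Box$ + Mon$_\Diamond$; $\mathsf{WMN}$ := $\mathsf{WM}$+N$_\Box$;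 $\mathsf{WMC}$ := $\mathsf{WM}$+C$_\Box$+K$_\Diamond$; $\mathsf{WK}$ := $\mathsf{WMC}$+N$_\Box$; $\mathsf{WMP}$ := $\mathsf{WM}$+P$_\Diamond$; $\mathsf{WMNP}$ := $\mathsf{WMN}$+P$_\Diamond$; $\mathsf{WMD}$ := $\mathsf{WM}$+D+P$_\Diamond$; $\mathsf{WMND}$ := $\mathsf{WMN}$+D; $\mathsf{WMCD}$ := $\mathsf{WMC}$+D+P$_\Diamond$; $\mathsf{WKD}$ := $\mathsf{WK}$+D; $\mathsf{WMT}$, $\mathsf{WMNT}$, $\mathsf{WMCT}$, $\mathsf{WKT}$ := respectively $\mathsf{WM}$, $\mathsf{WMN}$, $\mathsf{WMC}$, $\mathsf{WK}$ + T$_\Box$ + T$_\Diamond$. $\mathsf{WL}\vdash A$ means $A$ is derivable from axiom instances of $\mathsf{WL}$ by modus ponens and the rules of $\mathsf{WL}$. -}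

module Defs where

open import Data.Nat using (ℕ)
open import Data.Unit using (⊤)
open import Data.Empty using (⊥)
open import Data.Product using (_×_)
open import Relation.Binary.PropositionalEquality using (_≡_)

Atm : Set
Atm = ℕ

infixr 6 _∧'_
infixr 5 _∨'_
infixr 4 _⇒_

data Formula : Set where
  var  : Atm → Formula
  ⊥'   : Formula
  _∧'_ : Formula → Formula → Formula
  _∨'_ : Formula → Formula → Formula
  _⇒_  : Formula → Formula → Formula
  □    : Formula → Formula
  ◇    : Formula → Formula

⊤' : Formula
⊤' = ⊥' ⇒ ⊥'

¬' : Formula → Formula
¬' A = A ⇒ ⊥'

data WLogic : Set where
  WM WMN WMC WK WMP WMNP WMD WMND WMCD WKD WMT WMNT WMCT WKT : WLogic

HasN : WLogic → Set
HasN WMN  = ⊤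
HasN WK   = ⊤
HasN WMNP = ⊤
HasN WMND = ⊤
HasN WKD  = ⊤
HasN WMNT = ⊤
HasN WKT  = ⊤
HasN _    = ⊥

HasC : WLogic → Set
HasC WMC  = ⊤
HasC WK   = ⊤
HasC WMCD = ⊤
HasC WKD  = ⊤
HasC WMCT = ⊤
HasC WKT  = ⊤
HasC _    = ⊥

HasP : WLogic → Set
HasP WMP  = ⊤
HasP WMNP = ⊤
HasP WMD  = ⊤
HasP WMCD = ⊤
HasP _    = ⊥

HasD : WLogic → Set
HasD WMD  = ⊤
HasD WMND = ⊤
HasD WMCD = ⊤
HasD WKD  = ⊤
HasD _    = ⊥

HasT : WLogic → Set
HasT WMT  = ⊤
HasT WMNT = ⊤
HasT WMCT = ⊤
HasT WKT  = ⊤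
HasT _    = ⊥

infix 2 _⊢_

data _⊢_ (L : WLogic) : Formula → Set where
  ax-K    : ∀ A B → L ⊢ A ⇒ (B ⇒ A)
  ax-S    : ∀ A B C → L ⊢ (A ⇒ (B ⇒ C)) ⇒ ((A ⇒ B) ⇒ (A ⇒ C))
  ax-∧E₁  : ∀ A B → L ⊢ A ∧' B ⇒ A
  ax-∧E₂  : ∀ A B → L ⊢ A ∧' B ⇒ B
  ax-∧I   : ∀ A B → L ⊢ A ⇒ (B ⇒ A ∧' B)
  ax-∨I₁  : ∀ A B → L ⊢ A ⇒ A ∨' B
  ax-∨I₂  : ∀ A B → L ⊢ B ⇒ A ∨' B
  ax-∨E   : ∀ A B C → L ⊢ (A ⇒ C) ⇒ ((B ⇒ C) ⇒ (A ∨' B ⇒ C))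
  ax-⊥E   : ∀ A → L ⊢ ⊥' ⇒ A
  mp      : ∀ {A B} → L ⊢ A ⇒ B → L ⊢ A → L ⊢ B
  dual∧   : ∀ A → L ⊢ ¬' (□ A ∧' ◇ (¬' A))
  mon□    : ∀ {A B} → L ⊢ A ⇒ B → L ⊢ □ A ⇒ □ B
  mon◇    : ∀ {A B} → L ⊢ A ⇒ B → L ⊢ ◇ A ⇒ ◇ B
  N□      : HasN L → L ⊢ □ ⊤'
  C□      : HasC L → ∀ A B → L ⊢ □ A ∧' □ B ⇒ □ (A ∧' B)
  K◇      : HasC L → ∀ A B → L ⊢ □ (A ⇒ B) ⇒ (◇ A ⇒ ◇ B)
  P◇      : HasP L → L ⊢ ◇ ⊤'
  axD     : HasD L → ∀ A → L ⊢ □ A ⇒ ◇ A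
  T□      : HasT L → ∀ A → L ⊢ □ A ⇒ A
  T◇      : HasT L → ∀ A → L ⊢ A ⇒ ◇ A

-- Symbols counted by var(A): ⊥ together with propositional variables.
data Sym : Set where
  sym⊥   : Sym
  symAtm : Atm → Sym

data _∈var_ : Sym → Formula → Set where
  bot∈   : ∀ {A} → sym⊥ ∈var A
  here   : ∀ {p} → symAtm p ∈var var p
  ∧l     : ∀ {s A B} → s ∈var A → s ∈var (A ∧' B)
  ∧r     : ∀ {s A B} → s ∈var B → s ∈var (A ∧' B)
  ∨l     : ∀ {s A B} → s ∈var A → s ∈var (A ∨' B)
  ∨r     : ∀ {s A B} → s ∈var B → s ∈var (A ∨' B)
  ⇒l     : ∀ {s A B} → s ∈var A → s ∈var (A ⇒ B)
  ⇒r     : ∀ {s A B} → s ∈var B → s ∈var (A ⇒ B)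
  □∈     : ∀ {s A} → s ∈var A → s ∈var □ A
  ◇∈     : ∀ {s A} → s ∈var A → s ∈var ◇ A

VarsIn : Formula → Formula → Formula → Set
VarsIn C A B = ∀ s → s ∈var C → (s ∈var A) × (s ∈var B)

-- Maehara's method. The W-logic L has a cut-free sequent calculus whose modal rules have
-- boxed premises □φ₁ … □φₙ and at most one ◇Y, with a side condition on n recording which
-- of N□, C□/K◇, ◇⊤ and □A → ◇A the rule needs. Every rule is derivable in L and cut is
-- admissible, so the calculus proves exactly the theorems of L. Given a cut-free proof of
-- A ⊢ B, split its antecedent as {A} | ∅ and build, by induction on the derivation, a
-- formula I with Γ₁ ⊢ I and I, Γ₂ ⊢ C whose atoms occur on both sides. Propositional rules
-- combine interpolants as usual. A modal rule distributes its boxed premises over the two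
-- sides, and the interpolant J of its premise becomes □J, ◇J, ⊤ or ⊥; the side condition
-- of the rule covers both halves.

module Submission where

open import Defs
open import Data.Product using (Σ; _×_; _,_; proj₁; proj₂)
open import Data.Sum using (_⊎_; inj₁; inj₂)
open import Data.Nat using (ℕ; zero; suc; _+_; _≤_; z≤n; s≤s)
open import Data.Nat.Properties using (+-suc; +-identityʳ; ≤-refl; m≤n⇒m≤1+n; n≤1+n; m≤m+n; m≤n+m)
open import Data.Unit using (⊤; tt)
open import Data.Empty using (⊥; ⊥-elim)
open import Function using (id)
open import Data.Maybe using (Maybe; just; nothing)
import Data.Maybe.Relation.Unary.All as Maybe
open import Data.List using (List; []; _∷_; _++_; length; foldr; fromMaybe)
open import Data.List.Properties using (length-++)
open import Data.List.Relation.Unary.All using (All; []; _∷_)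
import Data.List.Relation.Unary.All as All
import Data.List.Relation.Unary.All.Properties as All
open import Data.List.Relation.Unary.Any using (Any; here; there)
open import Data.List.Relation.Unary.Any.Properties using (singleton⁻)
open import Data.List.Membership.Propositional using (_∈_; lose)
open import Data.List.Membership.Propositional.Properties using (∈-++⁻)
open import Data.List.Relation.Binary.Subset.Propositional using (_⊆_)
open import Data.List.Relation.Binary.Subset.Propositional.Properties
  using (⊆-refl; ⊆-trans; xs⊆x∷xs; ∷⁺ʳ; ∈-∷⁺ʳ; xs⊆xs++ys; xs⊆ys++xs; ++⁺ʳ; ⊆-reflexive-↭)
open import Data.List.Relation.Binary.Permutation.Propositional using (↭-sym)
open import Data.List.Relation.Binary.Permutation.Propositional.Properties using (shift)
open import Relation.Binary.PropositionalEquality using (_≡_; refl; sym; trans; cong; subst)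

Ctx : Set
Ctx = List Formula

variable
  A B C X Y Z : Formula
  Γ Γ₁ Γ₂ Δ Θ Φ Φ₁ Φ₂ Ψ : Ctx
  mY : Maybe Formula
  m n : ℕ

⊆-shift : ∀ Π → A ∷ Π ++ Γ ⊆ Π ++ A ∷ Γ
⊆-shift Π = ⊆-reflexive-↭ (↭-sym (shift _ Π _))

++-⊆ : Γ ⊆ Θ → Δ ⊆ Θ → Γ ++ Δ ⊆ Θ
++-⊆ {Γ} s t q with ∈-++⁻ Γ q
... | inj₁ r = s r
... | inj₂ r = t r

⊆-past : Δ ⊆ A ∷ Θ → Δ ⊆ A ∷ Z ∷ Θ
⊆-past s = ⊆-trans s (∷⁺ʳ _ (xs⊆x∷xs _ _))

⊆-under : Δ ⊆ A ∷ Θ → Z ∷ Δ ⊆ A ∷ Z ∷ Θ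
⊆-under s = ∈-∷⁺ʳ (there (here refl)) (⊆-past s)

BoxedIn : Ctx → Ctx → Set
BoxedIn Φ Γ = All (λ φ → □ φ ∈ Γ) Φ

DiamondIn : Maybe Formula → Ctx → Set
DiamondIn mY Γ = Maybe.All (λ Y → ◇ Y ∈ Γ) mY

BoxedIn-⊆ : Γ ⊆ Δ → BoxedIn Φ Γ → BoxedIn Φ Δ
BoxedIn-⊆ s = All.map s

DiamondIn-⊆ : Γ ⊆ Δ → DiamondIn mY Γ → DiamondIn mY Δ
DiamondIn-⊆ s = Maybe.map s

data BoxedInCut (A : Formula) (Φ Θ : Ctx) : Set where
  boxes-kept : BoxedIn Φ Θ → BoxedInCut A Φ Θ
  box-cut    : A ≡ □ X → BoxedIn Ψ Θ → Φ ⊆ X ∷ Ψ → suc (length Ψ) ≤ length Φ →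
               BoxedInCut A Φ Θ

boxedInCut : BoxedIn Φ Δ → Δ ⊆ A ∷ Θ → BoxedInCut A Φ Θ
boxedInCut [] s = boxes-kept []
boxedInCut {φ ∷ Φ} (p ∷ b) s with s p | boxedInCut b s
... | there q   | boxes-kept b′ = boxes-kept (q ∷ b′)
... | here refl | boxes-kept b′ = box-cut refl b′ (∷⁺ʳ φ ⊆-refl) ≤-refl
... | here refl | box-cut refl b′ sub le = box-cut refl b′ (∈-∷⁺ʳ (here refl) sub) (m≤n⇒m≤1+n le)
... | there q   | box-cut eq b′ sub le =
  box-cut eq (q ∷ b′) (∈-∷⁺ʳ (there (here refl)) (⊆-past sub)) (s≤s le)

data DiamondInCut (A : Formula) (mY : Maybe Formula) (Θ : Ctx) : Set where
  diamond-kept : DiamondIn mY Θ → DiamondInCut A mY Θ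
  diamond-cut  : mY ≡ just Y → A ≡ ◇ Y → DiamondInCut A mY Θ

diamondInCut : DiamondIn mY Δ → Δ ⊆ A ∷ Θ → DiamondInCut A mY Θ
diamondInCut Maybe.nothing  _ = diamond-kept Maybe.nothing
diamondInCut (Maybe.just m) s with s m
... | here eq = diamond-cut refl (sym eq)
... | there q = diamond-kept (Maybe.just q)

infix 4 _⊆_∪_

_⊆_∪_ : Ctx → Ctx → Ctx → Set
Γ ⊆ Γ₁ ∪ Γ₂ = ∀ {x} → x ∈ Γ → x ∈ Γ₁ ⊎ x ∈ Γ₂

∪-swap : Γ ⊆ Γ₁ ∪ Γ₂ → Γ ⊆ Γ₂ ∪ Γ₁
∪-swap c q with c q
... | inj₁ r = inj₂ r
... | inj₂ r = inj₁ r

∪-∷ˡ : Γ ⊆ Γ₁ ∪ Γ₂ → A ∷ Γ ⊆ A ∷ Γ₁ ∪ Γ₂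
∪-∷ˡ c (here e)  = inj₁ (here e)
∪-∷ˡ c (there q) with c q
... | inj₁ r = inj₁ (there r)
... | inj₂ r = inj₂ r

∪-∷ʳ : Γ ⊆ Γ₁ ∪ Γ₂ → A ∷ Γ ⊆ Γ₁ ∪ A ∷ Γ₂
∪-∷ʳ c = ∪-swap (∪-∷ˡ (∪-swap c))

record BoxedInSplit (Φ Γ₁ Γ₂ : Ctx) : Set where
  constructor boxedInSplit
  field
    {Φˡ Φʳ}  : Ctx
    boxedˡ   : BoxedIn Φˡ Γ₁
    boxedʳ   : BoxedIn Φʳ Γ₂
    cover    : Φ ⊆ Φˡ ∪ Φʳ
    length-≡ : length Φˡ + length Φʳ ≡ length Φ

splitBoxedIn : BoxedIn Φ Γ → Γ ⊆ Γ₁ ∪ Γ₂ → BoxedInSplit Φ Γ₁ Γ₂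
splitBoxedIn [] c = boxedInSplit [] [] (λ ()) refl
splitBoxedIn (p ∷ b) c with c p | splitBoxedIn b c
... | inj₁ q | boxedInSplit b₁ b₂ cov len =
  boxedInSplit (q ∷ b₁) b₂ (∪-∷ˡ cov) (cong suc len)
... | inj₂ q | boxedInSplit {Φ₁} {Φ₂} b₁ b₂ cov len =
  boxedInSplit b₁ (q ∷ b₂) (∪-∷ʳ cov) (trans (+-suc (length Φ₁) (length Φ₂)) (cong suc len))

infix 4 _∈ᵃ_ _⊆ᵃ_

_∈ᵃ_ : Atm → Ctx → Set
p ∈ᵃ Γ = Any (symAtm p ∈var_) Γ

AtomsIn : Formula → Ctx → Set
AtomsIn A Γ = ∀ {p} → symAtm p ∈var A → p ∈ᵃ Γ

_⊆ᵃ_ : Ctx → Ctx → Set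
Γ ⊆ᵃ Δ = ∀ {p} → p ∈ᵃ Γ → p ∈ᵃ Δ

AtomsIn-⊆ᵃ : AtomsIn A Γ → Γ ⊆ᵃ Δ → AtomsIn A Δ
AtomsIn-⊆ᵃ a f o = f (a o)

AtomsIn-⊤ : AtomsIn ⊤' Γ
AtomsIn-⊤ (⇒l ())
AtomsIn-⊤ (⇒r ())

AtomsIn-⊥ : AtomsIn ⊥' Γ
AtomsIn-⊥ ()

AtomsIn-∧ : AtomsIn A Γ → AtomsIn B Γ → AtomsIn (A ∧' B) Γ
AtomsIn-∧ a b (∧l o) = a o
AtomsIn-∧ a b (∧r o) = b o

AtomsIn-∨ : AtomsIn A Γ → AtomsIn B Γ → AtomsIn (A ∨' B) Γ
AtomsIn-∨ a b (∨l o) = a o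
AtomsIn-∨ a b (∨r o) = b o

AtomsIn-⇒ : AtomsIn A Γ → AtomsIn B Γ → AtomsIn (A ⇒ B) Γ
AtomsIn-⇒ a b (⇒l o) = a o
AtomsIn-⇒ a b (⇒r o) = b o

AtomsIn-□ : AtomsIn A Φ → Φ ⊆ᵃ Γ → AtomsIn (□ A) Γ
AtomsIn-□ a f (□∈ o) = f (a o)

AtomsIn-◇ : AtomsIn A Φ → Φ ⊆ᵃ Γ → AtomsIn (◇ A) Γ
AtomsIn-◇ a f (◇∈ o) = f (a o)

∷-⊆ᵃ : AtomsIn A Δ → Γ ⊆ᵃ Δ → A ∷ Γ ⊆ᵃ Δ
∷-⊆ᵃ a f (here o)  = a o
∷-⊆ᵃ a f (there q) = f q

∷-⊆ᵃ-∷ : (∀ {p} → symAtm p ∈var A → symAtm p ∈var B) → Γ ⊆ᵃ Δ → A ∷ Γ ⊆ᵃ B ∷ Δ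
∷-⊆ᵃ-∷ f g = ∷-⊆ᵃ (λ o → here (f o)) (λ q → there (g q))

∈-⊆ᵃ : B ∈ Δ → (∀ {p} → symAtm p ∈var A → symAtm p ∈var B) → Γ ⊆ᵃ Δ → A ∷ Γ ⊆ᵃ Δ
∈-⊆ᵃ q f = ∷-⊆ᵃ (λ o → lose q (f o))

BoxedIn⇒⊆ᵃ : BoxedIn Φ Γ → Φ ⊆ᵃ Γ
BoxedIn⇒⊆ᵃ (q ∷ b) (here o)  = lose q (□∈ o)
BoxedIn⇒⊆ᵃ (q ∷ b) (there a) = BoxedIn⇒⊆ᵃ b a

⊢-refl : ∀ L A → L ⊢ A ⇒ A
⊢-refl L A = mp (mp (ax-S A (A ⇒ A) A) (ax-K A (A ⇒ A))) (ax-K A A)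

⊢-trans : ∀ L → L ⊢ A ⇒ B → L ⊢ B ⇒ C → L ⊢ A ⇒ C
⊢-trans {A} {B} {C} L f g = mp (mp (ax-S A B C) (mp (ax-K (B ⇒ C) A) g)) f

-- The logics proving ◇⊤, resp. □A → ◇A, listed by name so that these predicates compute.
Has◇⊤ : WLogic → Set
Has◇⊤ WMP  = ⊤
Has◇⊤ WMNP = ⊤
Has◇⊤ WMD  = ⊤
Has◇⊤ WMND = ⊤
Has◇⊤ WMCD = ⊤
Has◇⊤ WKD  = ⊤
Has◇⊤ WMT  = ⊤
Has◇⊤ WMNT = ⊤
Has◇⊤ WMCT = ⊤
Has◇⊤ WKT  = ⊤
Has◇⊤ _    = ⊥

Has□◇ : WLogic → Set
Has□◇ WMD  = ⊤
Has□◇ WMND = ⊤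
Has□◇ WMCD = ⊤
Has□◇ WKD  = ⊤
Has□◇ WMT  = ⊤
Has□◇ WMNT = ⊤
Has□◇ WMCT = ⊤
Has□◇ WKT  = ⊤
Has□◇ _    = ⊥

HasP⇒Has◇⊤ : ∀ L → HasP L → Has◇⊤ L
HasP⇒Has◇⊤ WMP  _ = tt
HasP⇒Has◇⊤ WMNP _ = tt
HasP⇒Has◇⊤ WMD  _ = tt
HasP⇒Has◇⊤ WMCD _ = tt

HasD⇒Has□◇ : ∀ L → HasD L → Has□◇ L
HasD⇒Has□◇ WMD  _ = tt
HasD⇒Has□◇ WMND _ = tt
HasD⇒Has□◇ WMCD _ = tt
HasD⇒Has□◇ WKD  _ = tt

Has□◇⇒Has◇⊤ : ∀ L → Has□◇ L → Has◇⊤ L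
Has□◇⇒Has◇⊤ WMD  _ = tt
Has□◇⇒Has◇⊤ WMND _ = tt
Has□◇⇒Has◇⊤ WMCD _ = tt
Has□◇⇒Has◇⊤ WKD  _ = tt
Has□◇⇒Has◇⊤ WMT  _ = tt
Has□◇⇒Has◇⊤ WMNT _ = tt
Has□◇⇒Has◇⊤ WMCT _ = tt
Has□◇⇒Has◇⊤ WKT  _ = tt

-- K◇ and mon□ turn ◇⊤ into □A → ◇A; among the W-logics this is visible by inspection.
HasC⇒Has◇⊤⇒Has□◇ : ∀ L → HasC L → Has◇⊤ L → Has□◇ L
HasC⇒Has◇⊤⇒Has□◇ WMCD _ _ = tt
HasC⇒Has◇⊤⇒Has□◇ WKD  _ _ = tt
HasC⇒Has◇⊤⇒Has□◇ WMCT _ _ = tt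
HasC⇒Has◇⊤⇒Has□◇ WKT  _ _ = tt

⊢◇⊤ : ∀ L → Has◇⊤ L → L ⊢ ◇ ⊤'
⊢◇⊤ WMP  _ = P◇ tt
⊢◇⊤ WMNP _ = P◇ tt
⊢◇⊤ WMD  _ = P◇ tt
⊢◇⊤ WMCD _ = P◇ tt
⊢◇⊤ WMND _ = mp (axD tt ⊤') (N□ tt)
⊢◇⊤ WKD  _ = mp (axD tt ⊤') (N□ tt)
⊢◇⊤ WMT  _ = mp (T◇ tt ⊤') (⊢-refl WMT ⊥')
⊢◇⊤ WMNT _ = mp (T◇ tt ⊤') (⊢-refl WMNT ⊥')
⊢◇⊤ WMCT _ = mp (T◇ tt ⊤') (⊢-refl WMCT ⊥')
⊢◇⊤ WKT  _ = mp (T◇ tt ⊤') (⊢-refl WKT ⊥')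

⊢□⇒◇ : ∀ L → Has□◇ L → ∀ A → L ⊢ □ A ⇒ ◇ A
⊢□⇒◇ WMD  _ A = axD tt A
⊢□⇒◇ WMND _ A = axD tt A
⊢□⇒◇ WMCD _ A = axD tt A
⊢□⇒◇ WKD  _ A = axD tt A
⊢□⇒◇ WMT  _ A = ⊢-trans WMT (T□ tt A) (T◇ tt A)
⊢□⇒◇ WMNT _ A = ⊢-trans WMNT (T□ tt A) (T◇ tt A)
⊢□⇒◇ WMCT _ A = ⊢-trans WMCT (T□ tt A) (T◇ tt A)
⊢□⇒◇ WKT  _ A = ⊢-trans WKT (T□ tt A) (T◇ tt A)

module _ (L : WLogic) where

  -- The sequent calculus

  -- Side conditions on the number n of boxed premises of the modal rules: exactly what makes
  -- the rule derivable in L (see □R-sound, ◇R-sound and dualL-sound).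
  □Rule : ℕ → Set
  □Rule zero          = HasN L
  □Rule (suc zero)    = ⊤
  □Rule (suc (suc _)) = HasC L

  SerialRule : ℕ → Set
  SerialRule zero    = Has◇⊤ L
  SerialRule (suc n) = Has□◇ L × □Rule (suc n)

  ◇Rule : ℕ → Maybe Formula → Set
  ◇Rule n (just _) = □Rule (suc n)
  ◇Rule n nothing  = SerialRule n

  DualRule : ℕ → Maybe Formula → Set
  DualRule n       (just _) = □Rule n
  DualRule zero    nothing  = ⊤
  DualRule (suc n) nothing  = SerialRule n

  □Rule-C : HasC L → ∀ n → □Rule (suc n)
  □Rule-C c zero    = tt
  □Rule-C c (suc n) = c

  □Rule-≤ : m ≤ n → □Rule (suc n) → □Rule (suc m)
  □Rule-≤ z≤n     _ = tt
  □Rule-≤ (s≤s _) c = c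

  □Rule-+ : ∀ m n → □Rule (suc (m + n)) → □Rule (suc m) × □Rule (suc n)
  □Rule-+ m n b = □Rule-≤ (m≤m+n m n) b , □Rule-≤ (m≤n+m n m) b

  □Rule-+suc : ∀ m → □Rule (m + suc n) → □Rule (suc m) × □Rule (suc n)
  □Rule-+suc {n} m b = □Rule-+ m n (subst □Rule (+-suc m n) b)

  SerialRule⇒Has◇⊤ : ∀ n → SerialRule n → Has◇⊤ L
  SerialRule⇒Has◇⊤ zero    p       = p
  SerialRule⇒Has◇⊤ (suc n) (d , _) = Has□◇⇒Has◇⊤ L d

  SerialRule-□Rule : Has□◇ L → ∀ n → □Rule n → SerialRule n
  SerialRule-□Rule d zero    _ = Has□◇⇒Has◇⊤ L d
  SerialRule-□Rule d (suc n) b = d , b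

  SerialRule-C : HasC L → Has□◇ L → ∀ n → SerialRule n
  SerialRule-C c d zero    = Has□◇⇒Has◇⊤ L d
  SerialRule-C c d (suc n) = d , □Rule-C c n

  SerialRule-≤ : m ≤ n → SerialRule n → SerialRule m
  SerialRule-≤ {zero} {n} _     s       = SerialRule⇒Has◇⊤ n s
  SerialRule-≤ {suc m} (s≤s m≤n) (d , b) = d , □Rule-≤ m≤n b

  SerialRule-+suc : ∀ m → SerialRule (m + suc n) → □Rule (suc m) × SerialRule (suc n)
  SerialRule-+suc {n} m s with subst SerialRule (+-suc m n) s
  ... | d , b = proj₁ (□Rule-+ m n b) , d , proj₂ (□Rule-+ m n b)

  SerialRule⇒DualRule : ∀ n → SerialRule n → DualRule n nothing
  SerialRule⇒DualRule zero    _ = tt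
  SerialRule⇒DualRule (suc n) s = SerialRule-≤ (n≤1+n n) s

  Has◇⊤⇒□Rule⇒DualRule : Has◇⊤ L → ∀ n → □Rule n → DualRule n nothing
  Has◇⊤⇒□Rule⇒DualRule p zero          _ = tt
  Has◇⊤⇒□Rule⇒DualRule p (suc zero)    _ = p
  Has◇⊤⇒□Rule⇒DualRule p (suc (suc n)) c = HasC⇒Has◇⊤⇒Has□◇ L c p , □Rule-C c n

  -- Contexts are lists and every rule keeps its principal formula, so weakening and
  -- contraction are built in.
  infix 2 _⊢ˢ_

  data _⊢ˢ_ (Γ : Ctx) : Formula → Set where
    init  : A ∈ Γ → Γ ⊢ˢ A
    ⊥L    : ⊥' ∈ Γ → Γ ⊢ˢ C
    ∧R    : Γ ⊢ˢ A → Γ ⊢ˢ B → Γ ⊢ˢ A ∧' B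
    ∧L    : A ∧' B ∈ Γ → A ∷ B ∷ Γ ⊢ˢ C → Γ ⊢ˢ C
    ∨R₁   : Γ ⊢ˢ A → Γ ⊢ˢ A ∨' B
    ∨R₂   : Γ ⊢ˢ B → Γ ⊢ˢ A ∨' B
    ∨L    : A ∨' B ∈ Γ → A ∷ Γ ⊢ˢ C → B ∷ Γ ⊢ˢ C → Γ ⊢ˢ C
    ⇒R    : A ∷ Γ ⊢ˢ B → Γ ⊢ˢ A ⇒ B
    ⇒L    : (A ⇒ B) ∈ Γ → Γ ⊢ˢ A → B ∷ Γ ⊢ˢ C → Γ ⊢ˢ C
    T□L   : HasT L → □ A ∈ Γ → A ∷ Γ ⊢ˢ C → Γ ⊢ˢ C
    T◇R   : HasT L → Γ ⊢ˢ A → Γ ⊢ˢ ◇ A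
    □R    : □Rule (length Φ) → Φ ⊢ˢ B → BoxedIn Φ Γ → Γ ⊢ˢ □ B
    ◇R    : ◇Rule (length Φ) mY → fromMaybe mY ++ Φ ⊢ˢ B →
            BoxedIn Φ Γ → DiamondIn mY Γ → Γ ⊢ˢ ◇ B
    dualL : DualRule (length Φ) mY → fromMaybe mY ++ Φ ⊢ˢ ⊥' →
            BoxedIn Φ Γ → DiamondIn mY Γ → Γ ⊢ˢ C

  weaken : Γ ⊆ Δ → Γ ⊢ˢ C → Δ ⊢ˢ C
  weaken s (init p)          = init (s p)
  weaken s (⊥L p)            = ⊥L (s p)
  weaken s (∧R d e)          = ∧R (weaken s d) (weaken s e)
  weaken s (∧L p d)          = ∧L (s p) (weaken (∷⁺ʳ _ (∷⁺ʳ _ s)) d)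
  weaken s (∨R₁ d)           = ∨R₁ (weaken s d)
  weaken s (∨R₂ d)           = ∨R₂ (weaken s d)
  weaken s (∨L p d e)        = ∨L (s p) (weaken (∷⁺ʳ _ s) d) (weaken (∷⁺ʳ _ s) e)
  weaken s (⇒R d)            = ⇒R (weaken (∷⁺ʳ _ s) d)
  weaken s (⇒L p d e)        = ⇒L (s p) (weaken s d) (weaken (∷⁺ʳ _ s) e)
  weaken s (T□L t p d)       = T□L t (s p) (weaken (∷⁺ʳ _ s) d)
  weaken s (T◇R t d)         = T◇R t (weaken s d)
  weaken s (□R ok d b)       = □R ok d (BoxedIn-⊆ s b)
  weaken s (◇R ok d b m)     = ◇R ok d (BoxedIn-⊆ s b) (DiamondIn-⊆ s m)
  weaken s (dualL ok d b m)  = dualL ok d (BoxedIn-⊆ s b) (DiamondIn-⊆ s m)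

  weaken-∷ : Γ ⊢ˢ C → A ∷ Γ ⊢ˢ C
  weaken-∷ = weaken there

  weaken-under : A ∷ Γ ⊢ˢ C → A ∷ B ∷ Γ ⊢ˢ C
  weaken-under = weaken (∷⁺ʳ _ there)

  exchange : A ∷ B ∷ Γ ⊢ˢ C → B ∷ A ∷ Γ ⊢ˢ C
  exchange {B = B} = weaken (⊆-shift (B ∷ []))

  ⊢ˢ⊤ : Γ ⊢ˢ ⊤'
  ⊢ˢ⊤ = ⇒R (⊥L (here refl))

  ∧L-head : A ∷ B ∷ Γ ⊢ˢ C → (A ∧' B) ∷ Γ ⊢ˢ C
  ∧L-head d = ∧L (here refl) (weaken (∷⁺ʳ _ (∷⁺ʳ _ there)) d)

  ∨L-head : A ∷ Γ ⊢ˢ C → B ∷ Γ ⊢ˢ C → (A ∨' B) ∷ Γ ⊢ˢ C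
  ∨L-head d e = ∨L (here refl) (weaken-under d) (weaken-under e)

  ⇒L-head : Γ ⊢ˢ A → B ∷ Γ ⊢ˢ C → (A ⇒ B) ∷ Γ ⊢ˢ C
  ⇒L-head d e = ⇒L (here refl) (weaken-∷ d) (weaken-under e)

  ⊢ˢ⊥⇒⊢ˢ : Γ ⊢ˢ ⊥' → Γ ⊢ˢ C
  ⊢ˢ⊥⇒⊢ˢ (init p)          = ⊥L p
  ⊢ˢ⊥⇒⊢ˢ (⊥L p)            = ⊥L p
  ⊢ˢ⊥⇒⊢ˢ (∧L p d)          = ∧L p (⊢ˢ⊥⇒⊢ˢ d)
  ⊢ˢ⊥⇒⊢ˢ (∨L p d e)        = ∨L p (⊢ˢ⊥⇒⊢ˢ d) (⊢ˢ⊥⇒⊢ˢ e)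
  ⊢ˢ⊥⇒⊢ˢ (⇒L p d e)        = ⇒L p d (⊢ˢ⊥⇒⊢ˢ e)
  ⊢ˢ⊥⇒⊢ˢ (T□L t p d)       = T□L t p (⊢ˢ⊥⇒⊢ˢ d)
  ⊢ˢ⊥⇒⊢ˢ (dualL ok d b m)  = dualL ok d b m

  T□L* : HasT L → BoxedIn Φ Θ → Φ ++ Θ ⊢ˢ C → Θ ⊢ˢ C
  T□L* t []               d = d
  T□L* {φ ∷ Φ} t (p ∷ b)  d = T□L t p (T□L* t (BoxedIn-⊆ there b) (weaken (⊆-shift Φ) d))

  -- Cut admissibility

  -- Cutting a premise □X against □R for X replaces □X by that rule's k premises.
  □Rule-merge : ∀ k {n r} → □Rule k → □Rule n → suc r ≤ n → □Rule (k + r)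
  □Rule-merge k {r = zero}  b _ _ = subst □Rule (sym (+-identityʳ k)) b
  □Rule-merge k {r = suc r} _ c (s≤s (s≤s _)) =
    subst □Rule (sym (+-suc k r)) (□Rule-C c (k + r))

  ◇Rule-merge : ∀ k {n r} mY → □Rule k → ◇Rule n mY → suc r ≤ n → ◇Rule (k + r) mY
  ◇Rule-merge k {r = r} (just _) _ c (s≤s _) = □Rule-C c (k + r)
  ◇Rule-merge k {r = zero} nothing b (d , _) (s≤s _) =
    subst SerialRule (sym (+-identityʳ k)) (SerialRule-□Rule d k b)
  ◇Rule-merge k {r = suc r} nothing _ (d , c) (s≤s (s≤s _)) = SerialRule-C c d (k + suc r)

  DualRule-merge : ∀ k {n r} mY → □Rule k → DualRule n mY → suc r ≤ n → DualRule (k + r) mY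
  DualRule-merge k (just _) = □Rule-merge k
  DualRule-merge k {suc n} {zero} nothing b s _ =
    subst (λ j → DualRule j nothing) (sym (+-identityʳ k))
          (Has◇⊤⇒□Rule⇒DualRule (SerialRule⇒Has◇⊤ n s) k b)
  DualRule-merge zero {r = suc r} nothing _ s (s≤s (s≤s r≤n)) = SerialRule-≤ (m≤n⇒m≤1+n r≤n) s
  DualRule-merge (suc zero) {r = suc r} nothing _ s (s≤s (s≤s r≤n)) = SerialRule-≤ (s≤s r≤n) s
  DualRule-merge (suc (suc k)) {r = suc r} nothing c (d , _) (s≤s (s≤s _)) =
    SerialRule-C c d (suc k + suc r)

  -- Cutting the premise ◇X against ◇R for X: that rule's premises replace ◇X.
  ◇Rule-◇merge : ∀ k {n} mY → ◇Rule k mY → □Rule (suc n) → ◇Rule (k + n) mY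
  ◇Rule-◇merge k {zero} mY o _ = subst (λ j → ◇Rule j mY) (sym (+-identityʳ k)) o
  ◇Rule-◇merge k {suc n} (just _) _ c = □Rule-C c (k + suc n)
  ◇Rule-◇merge k {suc n} nothing s c =
    SerialRule-C c (HasC⇒Has◇⊤⇒Has□◇ L c (SerialRule⇒Has◇⊤ k s)) (k + suc n)

  DualRule-◇merge : ∀ k {n} mY → ◇Rule k mY → □Rule n → DualRule (k + n) mY
  DualRule-◇merge zero    (just _) _ b = b
  DualRule-◇merge (suc k) {n} (just _) c _ = □Rule-C c (k + n)
  DualRule-◇merge k {zero} nothing s _ =
    subst (λ j → DualRule j nothing) (sym (+-identityʳ k)) (SerialRule⇒DualRule k s)
  DualRule-◇merge k {suc n} nothing s b =
    subst (λ j → DualRule j nothing) (sym (+-suc k n)) (◇Rule-◇merge k nothing s b)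

  data RightIntro : Formula → Ctx → Set where
    ∧R  : Θ ⊢ˢ A → Θ ⊢ˢ B → RightIntro (A ∧' B) Θ
    ∨R₁ : Θ ⊢ˢ A → RightIntro (A ∨' B) Θ
    ∨R₂ : Θ ⊢ˢ B → RightIntro (A ∨' B) Θ
    ⇒R  : A ∷ Θ ⊢ˢ B → RightIntro (A ⇒ B) Θ
    T◇R : HasT L → Θ ⊢ˢ A → RightIntro (◇ A) Θ
    □R  : □Rule (length Φ) → Φ ⊢ˢ B → BoxedIn Φ Θ → RightIntro (□ B) Θ
    ◇R  : ◇Rule (length Φ) mY → fromMaybe mY ++ Φ ⊢ˢ B →
          BoxedIn Φ Θ → DiamondIn mY Θ → RightIntro (◇ B) Θ

  RightIntro-⊆ : Θ ⊆ Δ → RightIntro A Θ → RightIntro A Δ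
  RightIntro-⊆ s (∧R d e)      = ∧R (weaken s d) (weaken s e)
  RightIntro-⊆ s (∨R₁ d)       = ∨R₁ (weaken s d)
  RightIntro-⊆ s (∨R₂ d)       = ∨R₂ (weaken s d)
  RightIntro-⊆ s (⇒R d)        = ⇒R (weaken (∷⁺ʳ _ s) d)
  RightIntro-⊆ s (T◇R t d)     = T◇R t (weaken s d)
  RightIntro-⊆ s (□R ok d b)   = □R ok d (BoxedIn-⊆ s b)
  RightIntro-⊆ s (◇R ok d b m) = ◇R ok d (BoxedIn-⊆ s b) (DiamondIn-⊆ s m)

  RightIntro⇒⊢ˢ : RightIntro A Θ → Θ ⊢ˢ A
  RightIntro⇒⊢ˢ (∧R d e)      = ∧R d e
  RightIntro⇒⊢ˢ (∨R₁ d)       = ∨R₁ d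
  RightIntro⇒⊢ˢ (∨R₂ d)       = ∨R₂ d
  RightIntro⇒⊢ˢ (⇒R d)        = ⇒R d
  RightIntro⇒⊢ˢ (T◇R t d)     = T◇R t d
  RightIntro⇒⊢ˢ (□R ok d b)   = □R ok d b
  RightIntro⇒⊢ˢ (◇R ok d b m) = ◇R ok d b m

  ¬RightIntro⊥ : RightIntro ⊥' Θ → ⊥
  ¬RightIntro⊥ ()

  record BoxCut (Θ Π Ψ : Ctx) (G : Formula) : Set where
    constructor boxCut
    field
      {Φ′}    : Ctx
      rule    : □Rule (length Φ′)
      boxed   : BoxedIn Φ′ Θ
      premise : Π ++ (Φ′ ++ Ψ) ⊢ˢ G

  data DiamondCut (Θ Φ : Ctx) (G : Formula) : Set where
    via-T◇R : HasT L → Θ ⊢ˢ G → DiamondCut Θ Φ G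
    via-◇R  : ◇Rule (length Ψ) mY → BoxedIn Ψ Θ → DiamondIn mY Θ →
              fromMaybe mY ++ (Ψ ++ Φ) ⊢ˢ G → DiamondCut Θ Φ G

  -- Induction on the cut formula, then on the left and the right derivation: cutR takes
  -- over once the left derivation ends in a right rule, and its principal cases cut on
  -- immediate subformulas.
  mutual
    cut : ∀ A → Θ ⊢ˢ A → Δ ⊢ˢ C → Δ ⊆ A ∷ Θ → Θ ⊢ˢ C
    cut A (init p)         e s = weaken (⊆-trans s (∈-∷⁺ʳ p ⊆-refl)) e
    cut A (⊥L p)           e s = ⊥L p
    cut A (∧R d₁ d₂)       e s = cutR A (∧R d₁ d₂) e s
    cut A (∧L p d)         e s = ∧L p (cut A d e (⊆-past (⊆-past s)))
    cut A (∨R₁ d)          e s = cutR A (∨R₁ d) e s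
    cut A (∨R₂ d)          e s = cutR A (∨R₂ d) e s
    cut A (∨L p d₁ d₂)     e s = ∨L p (cut A d₁ e (⊆-past s)) (cut A d₂ e (⊆-past s))
    cut A (⇒R d)           e s = cutR A (⇒R d) e s
    cut A (⇒L p d₁ d₂)     e s = ⇒L p d₁ (cut A d₂ e (⊆-past s))
    cut A (T□L t p d)      e s = T□L t p (cut A d e (⊆-past s))
    cut A (T◇R t d)        e s = cutR A (T◇R t d) e s
    cut A (□R ok d b)      e s = cutR A (□R ok d b) e s
    cut A (◇R ok d b m)    e s = cutR A (◇R ok d b m) e s
    cut A (dualL ok d b m) e s = dualL ok d b m

    cut-∧ : ∀ A → RightIntro A Θ → X ∧' Y ≡ A → X ∷ Y ∷ Θ ⊢ˢ C → Θ ⊢ˢ C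
    cut-∧ (X ∧' Y) (∧R d₁ d₂) refl r =
      cut X d₁ (cut Y (weaken-∷ d₂) r (⊆-shift (Y ∷ []))) ⊆-refl

    cut-∨ : ∀ A → RightIntro A Θ → X ∨' Y ≡ A → X ∷ Θ ⊢ˢ C → Y ∷ Θ ⊢ˢ C → Θ ⊢ˢ C
    cut-∨ (X ∨' Y) (∨R₁ d) refl r₁ r₂ = cut X d r₁ ⊆-refl
    cut-∨ (X ∨' Y) (∨R₂ d) refl r₁ r₂ = cut Y d r₂ ⊆-refl

    cut-⇒ : ∀ A → RightIntro A Θ → (X ⇒ Y) ≡ A → Θ ⊢ˢ X → Y ∷ Θ ⊢ˢ C → Θ ⊢ˢ C
    cut-⇒ (X ⇒ Y) (⇒R d) refl r₁ r₂ = cut Y (cut X r₁ d ⊆-refl) r₂ ⊆-refl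

    cut-T□ : ∀ A → HasT L → RightIntro A Θ → □ X ≡ A → X ∷ Θ ⊢ˢ C → Θ ⊢ˢ C
    cut-T□ (□ X) t (□R {Φ} ok d b) refl r =
      cut X (T□L* t b (weaken (xs⊆xs++ys Φ _) d)) r ⊆-refl

    cut-□ : ∀ A → RightIntro A Θ → A ≡ □ X → (Π : Ctx) → Π ++ Φ ⊢ˢ C →
            Φ ⊆ X ∷ Ψ → BoxCut Θ Π Ψ C
    cut-□ {Ψ = Ψ} (□ X) (□R {Φ′} ok d b) refl Π e sub =
      boxCut ok b (cut X (weaken (⊆-trans (xs⊆xs++ys Φ′ Ψ) (xs⊆ys++xs _ Π)) d) e
        (++-⊆ (⊆-trans (xs⊆xs++ys Π _) (xs⊆x∷xs _ X))
              (⊆-trans sub (∷⁺ʳ X (⊆-trans (xs⊆ys++xs Ψ Φ′) (xs⊆ys++xs _ Π))))))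

    cut-◇ : ∀ A → RightIntro A Θ → A ≡ ◇ Y → Y ∷ Φ ⊢ˢ C → BoxedIn Φ Θ → DiamondCut Θ Φ C
    cut-◇ {Θ = Θ} {Φ = Φ} (◇ Y) (T◇R t d) refl e b =
      via-T◇R t (T□L* t b (cut Y (weaken (xs⊆ys++xs Θ Φ) d) e (∷⁺ʳ Y (xs⊆xs++ys Φ Θ))))
    cut-◇ {Φ = Φ} (◇ Y) (◇R {Φ′} {mY′} ok d b′ m) refl e b =
      via-◇R ok b′ m (cut Y (weaken (++⁺ʳ (fromMaybe mY′) (xs⊆xs++ys Φ′ Φ)) d) e
        (∷⁺ʳ Y (⊆-trans (xs⊆ys++xs Φ Φ′) (xs⊆ys++xs _ (fromMaybe mY′)))))

    cutR : ∀ A → RightIntro A Θ → Δ ⊢ˢ C → Δ ⊆ A ∷ Θ → Θ ⊢ˢ C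
    cutR A i (init p) s with s p
    ... | here refl = RightIntro⇒⊢ˢ i
    ... | there q   = init q
    cutR A i (⊥L p) s with s p
    ... | here refl = ⊥-elim (¬RightIntro⊥ i)
    ... | there q   = ⊥L q
    cutR A i (∧R e₁ e₂) s = ∧R (cutR A i e₁ s) (cutR A i e₂ s)
    cutR A i (∧L p e) s with s p
    ... | here eq = cut-∧ A i eq (cutR A (RightIntro-⊆ (⊆-trans there there) i) e
                                      (⊆-under (⊆-under s)))
    ... | there q = ∧L q (cutR A (RightIntro-⊆ (⊆-trans there there) i) e (⊆-under (⊆-under s)))
    cutR A i (∨R₁ e) s = ∨R₁ (cutR A i e s)
    cutR A i (∨R₂ e) s = ∨R₂ (cutR A i e s)
    cutR A i (∨L p e₁ e₂) s with s p
    ... | here eq = cut-∨ A i eq (cutR A (RightIntro-⊆ there i) e₁ (⊆-under s))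
                                 (cutR A (RightIntro-⊆ there i) e₂ (⊆-under s))
    ... | there q = ∨L q (cutR A (RightIntro-⊆ there i) e₁ (⊆-under s))
                         (cutR A (RightIntro-⊆ there i) e₂ (⊆-under s))
    cutR A i (⇒R e) s = ⇒R (cutR A (RightIntro-⊆ there i) e (⊆-under s))
    cutR A i (⇒L p e₁ e₂) s with s p
    ... | here eq = cut-⇒ A i eq (cutR A i e₁ s) (cutR A (RightIntro-⊆ there i) e₂ (⊆-under s))
    ... | there q = ⇒L q (cutR A i e₁ s) (cutR A (RightIntro-⊆ there i) e₂ (⊆-under s))
    cutR A i (T□L t p e) s with s p
    ... | here eq = cut-T□ A t i eq (cutR A (RightIntro-⊆ there i) e (⊆-under s))
    ... | there q = T□L t q (cutR A (RightIntro-⊆ there i) e (⊆-under s))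
    cutR A i (T◇R t e) s = T◇R t (cutR A i e s)
    cutR A i (□R ok e b) s with boxedInCut b s
    ... | boxes-kept b′ = □R ok e b′
    ... | box-cut eq b′ sub le with cut-□ A i eq [] e sub
    ...   | boxCut {Φ′} ok′ b″ e′ =
      □R (subst □Rule (sym (length-++ Φ′)) (□Rule-merge (length Φ′) ok′ ok le)) e′ (All.++⁺ b″ b′)
    cutR A i (◇R {mY = mY} ok e b m) s with boxedInCut b s | diamondInCut m s
    ... | boxes-kept b′ | diamond-kept m′ = ◇R ok e b′ m′
    ... | box-cut eq b′ sub le | diamond-kept m′ with cut-□ A i eq (fromMaybe mY) e sub
    ...   | boxCut {Φ′} ok′ b″ e′ =
      ◇R (subst (λ k → ◇Rule k mY) (sym (length-++ Φ′)) (◇Rule-merge (length Φ′) mY ok′ ok le))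
         e′ (All.++⁺ b″ b′) m′
    cutR A i (◇R ok e b m) s | boxes-kept b′ | diamond-cut refl eq with cut-◇ A i eq e b′
    ... | via-T◇R t d = T◇R t d
    ... | via-◇R {Ψ} {mY′} ok′ b″ m″ e′ =
      ◇R (subst (λ k → ◇Rule k mY′) (sym (length-++ Ψ)) (◇Rule-◇merge (length Ψ) mY′ ok′ ok))
         e′ (All.++⁺ b″ b′) m″
    cutR A i (◇R ok e b m) s | box-cut refl _ _ _ | diamond-cut _ ()
    cutR A i (dualL {mY = mY} ok e b m) s with boxedInCut b s | diamondInCut m s
    ... | boxes-kept b′ | diamond-kept m′ = dualL ok e b′ m′
    ... | box-cut eq b′ sub le | diamond-kept m′ with cut-□ A i eq (fromMaybe mY) e sub
    ...   | boxCut {Φ′} ok′ b″ e′ =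
      dualL (subst (λ k → DualRule k mY) (sym (length-++ Φ′))
                   (DualRule-merge (length Φ′) mY ok′ ok le))
            e′ (All.++⁺ b″ b′) m′
    cutR A i (dualL ok e b m) s | boxes-kept b′ | diamond-cut refl eq with cut-◇ A i eq e b′
    ... | via-T◇R t d = ⊢ˢ⊥⇒⊢ˢ d
    ... | via-◇R {Ψ} {mY′} ok′ b″ m″ e′ =
      dualL (subst (λ k → DualRule k mY′) (sym (length-++ Ψ))
                   (DualRule-◇merge (length Ψ) mY′ ok′ ok))
            e′ (All.++⁺ b″ b′) m″
    cutR A i (dualL ok e b m) s | box-cut refl _ _ _ | diamond-cut _ ()

  cut′ : Θ ⊢ˢ A → A ∷ Θ ⊢ˢ C → Θ ⊢ˢ C
  cut′ {A = A} d e = cut A d e ⊆-refl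

  -- Interpolation

  record Interpolant (Γ₁ Γ₂ : Ctx) (C : Formula) : Set where
    constructor interpolant
    field
      I           : Formula
      left        : Γ₁ ⊢ˢ I
      right       : I ∷ Γ₂ ⊢ˢ C
      atoms-left  : AtomsIn I Γ₁
      atoms-right : AtomsIn I (C ∷ Γ₂)

  interpolant-⊤ : Γ₂ ⊢ˢ C → Interpolant Γ₁ Γ₂ C
  interpolant-⊤ d = interpolant ⊤' ⊢ˢ⊤ (weaken-∷ d) AtomsIn-⊤ AtomsIn-⊤

  interpolant-⊥ : Γ₁ ⊢ˢ ⊥' → Interpolant Γ₁ Γ₂ C
  interpolant-⊥ d = interpolant ⊥' d (⊥L (here refl)) AtomsIn-⊥ AtomsIn-⊥

  Interpolant[]⇒⊢ˢ : Interpolant [] Γ₂ C → Γ₂ ⊢ˢ C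
  Interpolant[]⇒⊢ˢ (interpolant _ l r _ _) = cut′ (weaken (λ ()) l) r

  interpolant-□ : □Rule (length Φ₁ + length Φ₂) → BoxedIn Φ₁ Γ₁ → BoxedIn Φ₂ Γ₂ →
                  Interpolant Φ₁ Φ₂ B → Interpolant Γ₁ Γ₂ (□ B)
  interpolant-□ {Φ₁ = []} ok _ b₂ i = interpolant-⊤ (□R ok (Interpolant[]⇒⊢ˢ i) b₂)
  interpolant-□ {Φ₁ = _ ∷ Φ₁} {Φ₂} ok b₁ b₂ (interpolant J l r a₁ a₂)
    with □Rule-+ (length Φ₁) (length Φ₂) ok
  ... | ok₁ , ok₂ =
    interpolant (□ J)
      (□R ok₁ l b₁)
      (□R ok₂ r (here refl ∷ BoxedIn-⊆ there b₂))
      (AtomsIn-□ a₁ (BoxedIn⇒⊆ᵃ b₁))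
      (AtomsIn-□ a₂ (∷-⊆ᵃ-∷ □∈ (BoxedIn⇒⊆ᵃ b₂)))

  interpolant-◇ : SerialRule (length Φ₁ + length Φ₂) → BoxedIn Φ₁ Γ₁ → BoxedIn Φ₂ Γ₂ →
                  Interpolant Φ₁ Φ₂ B → Interpolant Γ₁ Γ₂ (◇ B)
  interpolant-◇ {Φ₁ = []} ok _ b₂ i = interpolant-⊤ (◇R ok (Interpolant[]⇒⊢ˢ i) b₂ Maybe.nothing)
  interpolant-◇ {Φ₁ = _ ∷ Φ₁} {Φ₂} (d , ok) b₁ b₂ (interpolant J l r a₁ a₂)
    with □Rule-+ (length Φ₁) (length Φ₂) ok
  ... | ok₁ , ok₂ =
    interpolant (□ J)
      (□R ok₁ l b₁)
      (◇R {mY = nothing} (d , ok₂) r (here refl ∷ BoxedIn-⊆ there b₂) Maybe.nothing)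
      (AtomsIn-□ a₁ (BoxedIn⇒⊆ᵃ b₁))
      (AtomsIn-□ a₂ (∷-⊆ᵃ-∷ ◇∈ (BoxedIn⇒⊆ᵃ b₂)))

  interpolant-◇ˡ : ◇ Y ∈ Γ₁ → □Rule (suc (length Φ₁ + length Φ₂)) → BoxedIn Φ₁ Γ₁ →
                   BoxedIn Φ₂ Γ₂ → Interpolant (Y ∷ Φ₁) Φ₂ B → Interpolant Γ₁ Γ₂ (◇ B)
  interpolant-◇ˡ {Φ₁ = Φ₁} {Φ₂} q ok b₁ b₂ (interpolant J l r a₁ a₂)
    with □Rule-+ (length Φ₁) (length Φ₂) ok
  ... | ok₁ , ok₂ =
    interpolant (◇ J)
      (◇R ok₁ l b₁ (Maybe.just q))
      (◇R ok₂ r (BoxedIn-⊆ there b₂) (Maybe.just (here refl)))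
      (AtomsIn-◇ a₁ (∈-⊆ᵃ q ◇∈ (BoxedIn⇒⊆ᵃ b₁)))
      (AtomsIn-◇ a₂ (∷-⊆ᵃ-∷ ◇∈ (BoxedIn⇒⊆ᵃ b₂)))

  interpolant-◇ʳ : ◇ Y ∈ Γ₂ → □Rule (suc (length Φ₁ + length Φ₂)) → BoxedIn Φ₁ Γ₁ →
                   BoxedIn Φ₂ Γ₂ → Interpolant Φ₁ (Y ∷ Φ₂) B → Interpolant Γ₁ Γ₂ (◇ B)
  interpolant-◇ʳ {Φ₁ = []} q ok _ b₂ i =
    interpolant-⊤ (◇R ok (Interpolant[]⇒⊢ˢ i) b₂ (Maybe.just q))
  interpolant-◇ʳ {Φ₁ = _ ∷ Φ₁} q c b₁ b₂ (interpolant J l r a₁ a₂) =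
    interpolant (□ J)
      (□R (□Rule-C c (length Φ₁)) l b₁)
      (◇R c (exchange r) (here refl ∷ BoxedIn-⊆ there b₂) (Maybe.just (there q)))
      (AtomsIn-□ a₁ (BoxedIn⇒⊆ᵃ b₁))
      (AtomsIn-□ a₂ (∷-⊆ᵃ-∷ ◇∈ (∈-⊆ᵃ q ◇∈ (BoxedIn⇒⊆ᵃ b₂))))

  interpolant-dual : DualRule (length Φ₁ + length Φ₂) nothing → BoxedIn Φ₁ Γ₁ →
                     BoxedIn Φ₂ Γ₂ → Interpolant Φ₁ Φ₂ ⊥' → Interpolant Γ₁ Γ₂ C
  interpolant-dual {Φ₁ = []} ok _ b₂ i =
    interpolant-⊤ (dualL ok (Interpolant[]⇒⊢ˢ i) b₂ Maybe.nothing)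
  interpolant-dual {Φ₁ = _ ∷ Φ₁} {Φ₂ = []} ok b₁ _ (interpolant J l r _ _) =
    interpolant-⊥ (dualL {mY = nothing} (subst SerialRule (+-identityʳ (length Φ₁)) ok)
                         (cut′ l (weaken (∷⁺ʳ J (λ ())) r)) b₁ Maybe.nothing)
  interpolant-dual {Φ₁ = _ ∷ Φ₁} {Φ₂ = _ ∷ _} ok b₁ b₂ (interpolant J l r a₁ a₂)
    with SerialRule-+suc (length Φ₁) ok
  ... | ok₁ , ok₂ =
    interpolant (□ J)
      (□R ok₁ l b₁)
      (dualL {mY = nothing} ok₂ r (here refl ∷ BoxedIn-⊆ there b₂) Maybe.nothing)
      (AtomsIn-□ a₁ (BoxedIn⇒⊆ᵃ b₁))
      (AtomsIn-□ a₂ (∷-⊆ᵃ-∷ (λ ()) (BoxedIn⇒⊆ᵃ b₂)))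

  interpolant-dualˡ : ◇ Y ∈ Γ₁ → □Rule (length Φ₁ + length Φ₂) → BoxedIn Φ₁ Γ₁ →
                      BoxedIn Φ₂ Γ₂ → Interpolant (Y ∷ Φ₁) Φ₂ ⊥' → Interpolant Γ₁ Γ₂ C
  interpolant-dualˡ {Φ₁ = Φ₁} {Φ₂ = []} q ok b₁ _ (interpolant J l r _ _) =
    interpolant-⊥ (dualL (subst □Rule (+-identityʳ (length Φ₁)) ok)
                         (cut′ l (weaken (∷⁺ʳ J (λ ())) r)) b₁ (Maybe.just q))
  interpolant-dualˡ {Φ₁ = Φ₁} {Φ₂ = _ ∷ _} q ok b₁ b₂ (interpolant J l r a₁ a₂)
    with □Rule-+suc (length Φ₁) ok
  ... | ok₁ , ok₂ =
    interpolant (◇ J)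
      (◇R ok₁ l b₁ (Maybe.just q))
      (dualL ok₂ r (BoxedIn-⊆ there b₂) (Maybe.just (here refl)))
      (AtomsIn-◇ a₁ (∈-⊆ᵃ q ◇∈ (BoxedIn⇒⊆ᵃ b₁)))
      (AtomsIn-◇ a₂ (∷-⊆ᵃ-∷ (λ ()) (BoxedIn⇒⊆ᵃ b₂)))

  interpolant-dualʳ : ◇ Y ∈ Γ₂ → □Rule (length Φ₁ + length Φ₂) → BoxedIn Φ₁ Γ₁ →
                      BoxedIn Φ₂ Γ₂ → Interpolant Φ₁ (Y ∷ Φ₂) ⊥' → Interpolant Γ₁ Γ₂ C
  interpolant-dualʳ {Φ₁ = []} q ok _ b₂ i =
    interpolant-⊤ (dualL ok (Interpolant[]⇒⊢ˢ i) b₂ (Maybe.just q))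
  interpolant-dualʳ {Φ₁ = _ ∷ Φ₁} {Φ₂} q ok b₁ b₂ (interpolant J l r a₁ a₂)
    with □Rule-+ (length Φ₁) (length Φ₂) ok
  ... | ok₁ , ok₂ =
    interpolant (□ J)
      (□R ok₁ l b₁)
      (dualL ok₂ (exchange r) (here refl ∷ BoxedIn-⊆ there b₂)
             (Maybe.just (there q)))
      (AtomsIn-□ a₁ (BoxedIn⇒⊆ᵃ b₁))
      (AtomsIn-□ a₂ (∷-⊆ᵃ-∷ (λ ()) (∈-⊆ᵃ q ◇∈ (BoxedIn⇒⊆ᵃ b₂))))

  interpolant-∧R : Interpolant Γ₁ Γ₂ A → Interpolant Γ₁ Γ₂ B → Interpolant Γ₁ Γ₂ (A ∧' B)
  interpolant-∧R (interpolant J₁ l₁ r₁ a₁ b₁) (interpolant J₂ l₂ r₂ a₂ b₂) =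
    interpolant (J₁ ∧' J₂) (∧R l₁ l₂) (∧L-head (∧R (weaken-under r₁) (weaken-∷ r₂)))
      (AtomsIn-∧ a₁ a₂)
      (AtomsIn-∧ (AtomsIn-⊆ᵃ b₁ (∷-⊆ᵃ-∷ ∧l id)) (AtomsIn-⊆ᵃ b₂ (∷-⊆ᵃ-∷ ∧r id)))

  interpolant-∨R₁ : Interpolant Γ₁ Γ₂ A → Interpolant Γ₁ Γ₂ (A ∨' B)
  interpolant-∨R₁ (interpolant J l r a b) =
    interpolant J l (∨R₁ r) a (AtomsIn-⊆ᵃ b (∷-⊆ᵃ-∷ ∨l id))

  interpolant-∨R₂ : Interpolant Γ₁ Γ₂ B → Interpolant Γ₁ Γ₂ (A ∨' B)
  interpolant-∨R₂ (interpolant J l r a b) =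
    interpolant J l (∨R₂ r) a (AtomsIn-⊆ᵃ b (∷-⊆ᵃ-∷ ∨r id))

  interpolant-⇒R : Interpolant Γ₁ (A ∷ Γ₂) B → Interpolant Γ₁ Γ₂ (A ⇒ B)
  interpolant-⇒R (interpolant J l r a b) =
    interpolant J l (⇒R (exchange r)) a
      (AtomsIn-⊆ᵃ b (∷-⊆ᵃ (λ o → here (⇒r o)) (∷-⊆ᵃ (λ o → here (⇒l o)) there)))

  interpolant-T◇R : HasT L → Interpolant Γ₁ Γ₂ A → Interpolant Γ₁ Γ₂ (◇ A)
  interpolant-T◇R t (interpolant J l r a b) =
    interpolant J l (T◇R t r) a (AtomsIn-⊆ᵃ b (∷-⊆ᵃ-∷ ◇∈ id))

  interpolant-∧Lˡ : X ∧' Y ∈ Γ₁ → Interpolant (X ∷ Y ∷ Γ₁) Γ₂ C → Interpolant Γ₁ Γ₂ C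
  interpolant-∧Lˡ q (interpolant J l r a b) =
    interpolant J (∧L q l) r (AtomsIn-⊆ᵃ a (∈-⊆ᵃ q ∧l (∈-⊆ᵃ q ∧r id))) b

  interpolant-∧Lʳ : X ∧' Y ∈ Γ₂ → Interpolant Γ₁ (X ∷ Y ∷ Γ₂) C → Interpolant Γ₁ Γ₂ C
  interpolant-∧Lʳ q (interpolant J l r a b) =
    interpolant J l (∧L (there q) (weaken (⊆-shift (_ ∷ _ ∷ [])) r)) a
      (AtomsIn-⊆ᵃ b (∷-⊆ᵃ-∷ id (∈-⊆ᵃ q ∧l (∈-⊆ᵃ q ∧r id))))

  interpolant-∨Lˡ : X ∨' Y ∈ Γ₁ → Interpolant (X ∷ Γ₁) Γ₂ C → Interpolant (Y ∷ Γ₁) Γ₂ C →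
                    Interpolant Γ₁ Γ₂ C
  interpolant-∨Lˡ q (interpolant J₁ l₁ r₁ a₁ b₁) (interpolant J₂ l₂ r₂ a₂ b₂) =
    interpolant (J₁ ∨' J₂) (∨L q (∨R₁ l₁) (∨R₂ l₂)) (∨L-head r₁ r₂)
      (AtomsIn-∨ (AtomsIn-⊆ᵃ a₁ (∈-⊆ᵃ q ∨l id)) (AtomsIn-⊆ᵃ a₂ (∈-⊆ᵃ q ∨r id)))
      (AtomsIn-∨ b₁ b₂)

  interpolant-∨Lʳ : X ∨' Y ∈ Γ₂ → Interpolant Γ₁ (X ∷ Γ₂) C → Interpolant Γ₁ (Y ∷ Γ₂) C →
                    Interpolant Γ₁ Γ₂ C
  interpolant-∨Lʳ q (interpolant J₁ l₁ r₁ a₁ b₁) (interpolant J₂ l₂ r₂ a₂ b₂) =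
    interpolant (J₁ ∧' J₂) (∧R l₁ l₂)
      (∧L-head (∨L (there (there q)) (weaken (∷⁺ʳ _ (∷⁺ʳ _ there)) (exchange r₁))
                                     (weaken (∷⁺ʳ _ there) (exchange r₂))))
      (AtomsIn-∧ a₁ a₂)
      (AtomsIn-∧ (AtomsIn-⊆ᵃ b₁ (∷-⊆ᵃ-∷ id (∈-⊆ᵃ q ∨l id)))
                 (AtomsIn-⊆ᵃ b₂ (∷-⊆ᵃ-∷ id (∈-⊆ᵃ q ∨r id))))

  -- The premise Γ ⊢ X of ⇒L is split with the two sides exchanged.
  interpolant-⇒Lˡ : (X ⇒ Y) ∈ Γ₁ → Interpolant Γ₂ Γ₁ X → Interpolant (Y ∷ Γ₁) Γ₂ C →
                    Interpolant Γ₁ Γ₂ C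
  interpolant-⇒Lˡ q (interpolant J l₁ r₁ a₁ b₁) (interpolant K l₂ r₂ a₂ b₂) =
    interpolant (J ⇒ K) (⇒R (⇒L (there q) r₁ (weaken-under l₂))) (⇒L-head l₁ r₂)
      (AtomsIn-⇒ (AtomsIn-⊆ᵃ b₁ (∈-⊆ᵃ q ⇒l id)) (AtomsIn-⊆ᵃ a₂ (∈-⊆ᵃ q ⇒r id)))
      (AtomsIn-⇒ (AtomsIn-⊆ᵃ a₁ there) b₂)

  interpolant-⇒Lʳ : (X ⇒ Y) ∈ Γ₂ → Interpolant Γ₁ Γ₂ X → Interpolant Γ₁ (Y ∷ Γ₂) C →
                    Interpolant Γ₁ Γ₂ C
  interpolant-⇒Lʳ q (interpolant J l₁ r₁ a₁ b₁) (interpolant K l₂ r₂ a₂ b₂) =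
    interpolant (J ∧' K) (∧R l₁ l₂)
      (∧L-head (⇒L (there (there q)) (weaken-under r₁) (weaken (∷⁺ʳ _ there) (exchange r₂))))
      (AtomsIn-∧ a₁ a₂)
      (AtomsIn-∧ (AtomsIn-⊆ᵃ b₁ (∈-⊆ᵃ (there q) ⇒l there))
                 (AtomsIn-⊆ᵃ b₂ (∷-⊆ᵃ-∷ id (∈-⊆ᵃ q ⇒r id))))

  interpolant-T□Lˡ : HasT L → □ X ∈ Γ₁ → Interpolant (X ∷ Γ₁) Γ₂ C → Interpolant Γ₁ Γ₂ C
  interpolant-T□Lˡ t q (interpolant J l r a b) =
    interpolant J (T□L t q l) r (AtomsIn-⊆ᵃ a (∈-⊆ᵃ q □∈ id)) b

  interpolant-T□Lʳ : HasT L → □ X ∈ Γ₂ → Interpolant Γ₁ (X ∷ Γ₂) C → Interpolant Γ₁ Γ₂ C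
  interpolant-T□Lʳ t q (interpolant J l r a b) =
    interpolant J l (T□L t (there q) (exchange r)) a
      (AtomsIn-⊆ᵃ b (∷-⊆ᵃ-∷ id (∈-⊆ᵃ q □∈ id)))

  interpolate : Γ ⊢ˢ C → Γ ⊆ Γ₁ ∪ Γ₂ → Interpolant Γ₁ Γ₂ C
  interpolate (init p) c with c p
  ... | inj₁ q = interpolant _ (init q) (init (here refl)) (lose q) here
  ... | inj₂ q = interpolant-⊤ (init q)
  interpolate (⊥L p) c with c p
  ... | inj₁ q = interpolant-⊥ (init q)
  ... | inj₂ q = interpolant-⊤ (⊥L q)
  interpolate (∧R d e)   c = interpolant-∧R (interpolate d c) (interpolate e c)
  interpolate (∨R₁ d)    c = interpolant-∨R₁ (interpolate d c)
  interpolate (∨R₂ d)    c = interpolant-∨R₂ (interpolate d c)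
  interpolate (⇒R d)     c = interpolant-⇒R (interpolate d (∪-∷ʳ c))
  interpolate (T◇R t d)  c = interpolant-T◇R t (interpolate d c)
  interpolate (∧L p d) c with c p
  ... | inj₁ q = interpolant-∧Lˡ q (interpolate d (∪-∷ˡ (∪-∷ˡ c)))
  ... | inj₂ q = interpolant-∧Lʳ q (interpolate d (∪-∷ʳ (∪-∷ʳ c)))
  interpolate (∨L p d e) c with c p
  ... | inj₁ q = interpolant-∨Lˡ q (interpolate d (∪-∷ˡ c)) (interpolate e (∪-∷ˡ c))
  ... | inj₂ q = interpolant-∨Lʳ q (interpolate d (∪-∷ʳ c)) (interpolate e (∪-∷ʳ c))
  interpolate (⇒L p d e) c with c p
  ... | inj₁ q = interpolant-⇒Lˡ q (interpolate d (∪-swap c)) (interpolate e (∪-∷ˡ c))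
  ... | inj₂ q = interpolant-⇒Lʳ q (interpolate d c) (interpolate e (∪-∷ʳ c))
  interpolate (T□L t p d) c with c p
  ... | inj₁ q = interpolant-T□Lˡ t q (interpolate d (∪-∷ˡ c))
  ... | inj₂ q = interpolant-T□Lʳ t q (interpolate d (∪-∷ʳ c))
  interpolate (□R ok d b) c with splitBoxedIn b c
  ... | boxedInSplit b₁ b₂ cov len =
    interpolant-□ (subst □Rule (sym len) ok) b₁ b₂ (interpolate d cov)
  interpolate (◇R {mY = nothing} ok d b _) c with splitBoxedIn b c
  ... | boxedInSplit b₁ b₂ cov len =
    interpolant-◇ (subst SerialRule (sym len) ok) b₁ b₂ (interpolate d cov)
  interpolate (◇R {mY = just _} ok d b (Maybe.just m)) c with c m | splitBoxedIn b c
  ... | inj₁ q | boxedInSplit b₁ b₂ cov len =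
    interpolant-◇ˡ q (subst (λ k → □Rule (suc k)) (sym len) ok) b₁ b₂ (interpolate d (∪-∷ˡ cov))
  ... | inj₂ q | boxedInSplit b₁ b₂ cov len =
    interpolant-◇ʳ q (subst (λ k → □Rule (suc k)) (sym len) ok) b₁ b₂ (interpolate d (∪-∷ʳ cov))
  interpolate (dualL {mY = nothing} ok d b _) c with splitBoxedIn b c
  ... | boxedInSplit b₁ b₂ cov len =
    interpolant-dual (subst (λ k → DualRule k nothing) (sym len) ok) b₁ b₂ (interpolate d cov)
  interpolate (dualL {mY = just _} ok d b (Maybe.just m)) c with c m | splitBoxedIn b c
  ... | inj₁ q | boxedInSplit b₁ b₂ cov len =
    interpolant-dualˡ q (subst □Rule (sym len) ok) b₁ b₂ (interpolate d (∪-∷ˡ cov))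
  ... | inj₂ q | boxedInSplit b₁ b₂ cov len =
    interpolant-dualʳ q (subst □Rule (sym len) ok) b₁ b₂ (interpolate d (∪-∷ʳ cov))

  -- Soundness and completeness

  infix 2 _⊩_

  data _⊩_ (Γ : Ctx) : Formula → Set where
    hyp : A ∈ Γ → Γ ⊩ A
    thm : L ⊢ A → Γ ⊩ A
    app : Γ ⊩ A ⇒ B → Γ ⊩ A → Γ ⊩ B

  deduction : A ∷ Γ ⊩ B → Γ ⊩ A ⇒ B
  deduction {A} (hyp (here refl)) = thm (⊢-refl L A)
  deduction {A} (hyp (there q))   = app (thm (ax-K _ A)) (hyp q)
  deduction {A} (thm t)           = app (thm (ax-K _ A)) (thm t)
  deduction {A} (app f x)         = app (app (thm (ax-S A _ _)) (deduction f)) (deduction x)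

  closed : [] ⊩ A → L ⊢ A
  closed (thm t)   = t
  closed (app f x) = mp (closed f) (closed x)

  ⊩⇒⊢ : A ∷ [] ⊩ B → L ⊢ A ⇒ B
  ⊩⇒⊢ d = closed (deduction d)

  substitute : (∀ {X} → X ∈ Φ → Δ ⊩ X) → Φ ⊩ A → Δ ⊩ A
  substitute σ (hyp q)   = σ q
  substitute σ (thm t)   = thm t
  substitute σ (app f x) = app (substitute σ f) (substitute σ x)

  ⊩-⊆ : Γ ⊆ Δ → Γ ⊩ A → Δ ⊩ A
  ⊩-⊆ s = substitute (λ q → hyp (s q))

  ∧I : Γ ⊩ A → Γ ⊩ B → Γ ⊩ A ∧' B
  ∧I a b = app (app (thm (ax-∧I _ _)) a) b

  ⊢-curry : L ⊢ A ∧' B ⇒ C → L ⊢ A ⇒ B ⇒ C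
  ⊢-curry f = ⊩⇒⊢ (deduction (app (thm f) (∧I (hyp (there (here refl))) (hyp (here refl)))))

  ⋀ : Ctx → Formula
  ⋀ = foldr _∧'_ ⊤'

  ⋀-∈ : Δ ⊩ ⋀ Φ → X ∈ Φ → Δ ⊩ X
  ⋀-∈ d (here refl) = app (thm (ax-∧E₁ _ _)) d
  ⋀-∈ d (there q)   = ⋀-∈ (app (thm (ax-∧E₂ _ _)) d) q

  ⊢⋀⇒ : Φ ⊩ B → L ⊢ ⋀ Φ ⇒ B
  ⊢⋀⇒ d = ⊩⇒⊢ (substitute (⋀-∈ (hyp (here refl))) d)

  ⊩□⋀ : □Rule (length Φ) → BoxedIn Φ Γ → Γ ⊩ □ (⋀ Φ)
  ⊩□⋀ n [] = thm (N□ n)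
  ⊩□⋀ _ (q ∷ []) = app (thm (mon□ (⊩⇒⊢ (∧I (hyp (here refl)) (thm (⊢-refl L ⊥')))))) (hyp q)
  ⊩□⋀ {_ ∷ _ ∷ Φ} c (q ∷ b) = app (thm (C□ c _ _)) (∧I (hyp q) (⊩□⋀ (□Rule-C c (length Φ)) b))

  ⊩◇⋀ : SerialRule (length Φ) → BoxedIn Φ Γ → Γ ⊩ ◇ (⋀ Φ)
  ⊩◇⋀ p       []      = thm (⊢◇⊤ L p)
  ⊩◇⋀ (d , n) (q ∷ b) = app (thm (⊢□⇒◇ L d _)) (⊩□⋀ n (q ∷ b))

  □R-sound : □Rule (length Φ) → Φ ⊩ B → BoxedIn Φ Γ → Γ ⊩ □ B
  □R-sound ok d b = app (thm (mon□ (⊢⋀⇒ d))) (⊩□⋀ ok b)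

  ◇R-sound : ◇Rule (length Φ) mY → fromMaybe mY ++ Φ ⊩ B → BoxedIn Φ Γ → DiamondIn mY Γ →
             Γ ⊩ ◇ B
  ◇R-sound {[]} _ d [] (Maybe.just q) = app (thm (mon◇ (⊩⇒⊢ d))) (hyp q)
  ◇R-sound {_ ∷ Φ} c d b (Maybe.just q) =
    app (app (thm (K◇ c _ _)) (□R-sound (□Rule-C c (length Φ)) (deduction d) b)) (hyp q)
  ◇R-sound ok d b Maybe.nothing = app (thm (mon◇ (⊢⋀⇒ d))) (⊩◇⋀ ok b)

  dualL-sound : DualRule (length Φ) mY → fromMaybe mY ++ Φ ⊩ ⊥' → BoxedIn Φ Γ →
                DiamondIn mY Γ → Γ ⊩ ⊥'
  dualL-sound {Φ} ok d b (Maybe.just q) =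
    app (thm (dual∧ (⋀ Φ))) (∧I (⊩□⋀ ok b) (app (thm (mon◇ (⊢-curry (⊢⋀⇒ d)))) (hyp q)))
  dualL-sound {[]} _ d [] Maybe.nothing = ⊩-⊆ (λ ()) d
  -- Without a ◇ premise, □φ is one half of Dual∧ and the other boxed premises give ◇¬φ.
  dualL-sound {φ ∷ _} ok d (q ∷ b) Maybe.nothing =
    app (thm (dual∧ φ)) (∧I (hyp q) (◇R-sound {mY = nothing} ok (deduction d) b Maybe.nothing))

  sound : Γ ⊢ˢ C → Γ ⊩ C
  sound (init p)         = hyp p
  sound (⊥L p)           = app (thm (ax-⊥E _)) (hyp p)
  sound (∧R d e)         = ∧I (sound d) (sound e)
  sound (∧L p d)         = substitute unpair (sound d)
    where
    unpair : X ∈ _ ∷ _ ∷ _ → _ ⊩ X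
    unpair (here refl)         = app (thm (ax-∧E₁ _ _)) (hyp p)
    unpair (there (here refl)) = app (thm (ax-∧E₂ _ _)) (hyp p)
    unpair (there (there q))   = hyp q
  sound (∨R₁ d)          = app (thm (ax-∨I₁ _ _)) (sound d)
  sound (∨R₂ d)          = app (thm (ax-∨I₂ _ _)) (sound d)
  sound (∨L p d e)       =
    app (app (app (thm (ax-∨E _ _ _)) (deduction (sound d))) (deduction (sound e))) (hyp p)
  sound (⇒R d)           = deduction (sound d)
  sound (⇒L p d e)       = app (deduction (sound e)) (app (hyp p) (sound d))
  sound (T□L t p d)      = app (deduction (sound d)) (app (thm (T□ t _)) (hyp p))
  sound (T◇R t d)        = app (thm (T◇ t _)) (sound d)
  sound (□R ok d b)      = □R-sound ok (sound d) b
  sound (◇R ok d b m)    = ◇R-sound ok (sound d) b m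
  sound (dualL ok d b m) = app (thm (ax-⊥E _)) (dualL-sound ok (sound d) b m)

  ⊢ˢ⇒⊢ : A ∷ [] ⊢ˢ B → L ⊢ A ⇒ B
  ⊢ˢ⇒⊢ d = ⊩⇒⊢ (sound d)

  ∈₀ : A ∈ A ∷ Γ
  ∈₀ = here refl

  ∈₁ : A ∈ B ∷ A ∷ Γ
  ∈₁ = there ∈₀

  ∈₂ : A ∈ C ∷ B ∷ A ∷ Γ
  ∈₂ = there ∈₁

  ∈₃ : A ∈ X ∷ C ∷ B ∷ A ∷ Γ
  ∈₃ = there ∈₂

  ⇒R⁻¹ : Γ ⊢ˢ A ⇒ B → A ∷ Γ ⊢ˢ B
  ⇒R⁻¹ d = cut′ (weaken-∷ d) (⇒L (here refl) (init (there (here refl))) (init (here refl)))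

  complete : L ⊢ A → [] ⊢ˢ A
  complete (ax-K _ _)     = ⇒R (⇒R (init ∈₁))
  complete (ax-S _ _ _)   =
    ⇒R (⇒R (⇒R (⇒L ∈₂ (init ∈₀) (⇒L ∈₂ (init ∈₁) (⇒L ∈₁ (init ∈₀) (init ∈₀))))))
  complete (ax-∧E₁ _ _)   = ⇒R (∧L ∈₀ (init ∈₀))
  complete (ax-∧E₂ _ _)   = ⇒R (∧L ∈₀ (init ∈₁))
  complete (ax-∧I _ _)    = ⇒R (⇒R (∧R (init ∈₁) (init ∈₀)))
  complete (ax-∨I₁ _ _)   = ⇒R (∨R₁ (init ∈₀))
  complete (ax-∨I₂ _ _)   = ⇒R (∨R₂ (init ∈₀))
  complete (ax-∨E _ _ _)  =
    ⇒R (⇒R (⇒R (∨L ∈₀ (⇒L ∈₃ (init ∈₀) (init ∈₀)) (⇒L ∈₂ (init ∈₀) (init ∈₀)))))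
  complete (ax-⊥E _)      = ⇒R (⊥L ∈₀)
  complete (mp f x)       = cut′ (complete f) (⇒L ∈₀ (weaken-∷ (complete x)) (init ∈₀))
  complete (dual∧ _)      =
    ⇒R (∧L ∈₀ (dualL tt (⇒L ∈₀ (init ∈₁) (init ∈₀)) (∈₀ ∷ []) (Maybe.just ∈₁)))
  complete (mon□ d)       = ⇒R (□R tt (⇒R⁻¹ (complete d)) (∈₀ ∷ []))
  complete (mon◇ d)       = ⇒R (◇R tt (⇒R⁻¹ (complete d)) [] (Maybe.just ∈₀))
  complete (N□ n)         = □R n ⊢ˢ⊤ []
  complete (C□ c _ _)     = ⇒R (∧L ∈₀ (□R c (∧R (init ∈₀) (init ∈₁)) (∈₀ ∷ ∈₁ ∷ [])))
  complete (K◇ c _ _)     =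
    ⇒R (⇒R (◇R c (⇒L ∈₁ (init ∈₀) (init ∈₀)) (∈₁ ∷ []) (Maybe.just ∈₀)))
  complete (P◇ p)         = ◇R {mY = nothing} (HasP⇒Has◇⊤ L p) ⊢ˢ⊤ [] Maybe.nothing
  complete (axD d _)      =
    ⇒R (◇R {mY = nothing} (HasD⇒Has□◇ L d , tt) (init ∈₀) (∈₀ ∷ []) Maybe.nothing)
  complete (T□ t _)       = ⇒R (T□L t ∈₀ (init ∈₀))
  complete (T◇ t _)       = ⇒R (T◇R t (init ∈₀))

theorem3p11 : (L : WLogic) (A B : Formula) → L ⊢ A ⇒ B →
    Σ Formula (λ C → (L ⊢ A ⇒ C) × (L ⊢ C ⇒ B) × VarsIn C A B)
theorem3p11 L A B ⊢A⇒B with interpolate L {Γ₂ = []} (⇒R⁻¹ L (complete L ⊢A⇒B)) inj₁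
... | interpolant I l r atomsˡ atomsʳ = I , ⊢ˢ⇒⊢ L l , ⊢ˢ⇒⊢ L r , common
  where
  common : VarsIn I A B
  common sym⊥       _ = bot∈ , bot∈
  common (symAtm p) o = singleton⁻ (atomsˡ o) , singleton⁻ (atomsʳ o)
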